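{- $\mathsf{RCA_0}$ proves: for every $n>0$ and every $f:\mathbb N\to\mathbb N$, $\mathcal A_n$ is a safe ISCT description of the program $A^n_f$. More precisely, $A_i$ is a safe description of the call $\tau_i$ for all $0<i\le n+1$, and $A_n$ is a safe description of the call $\tau_0$.
   Context: The program $A^n_f$ ($n>0$, $f$ a unary primitive operator with the given interpretation), with parameters $x_1,\dots,x_n,x_{n+1}$ where $x_{n+1}$ is written $y$, is: if $x_1=\dots=x_n=0$ then $f(y)$; else if $x_1>0\wedge x_2=\dots=x_n=0$ then $\tau_1: A(x_1-1,y,x_3,\dots,x_n,y)$; ...; else if $x_i>0\wedge x_{i+1}=\dots=x_n=0$ then $\tau_i: A(x_1,\dots,x_i-1,y,x_{i+2},\dots,x_n,y)$; ...; else if $x_{n-1}>0\wedge x_n=0$ then $\tau_{n-1}: A(x_1,\dots,x_{n-1}-1,y,y)$; else if $x_n>0\wedge y=0$ then $\tau_n: A(x_1,\dots,x_n-1,1)$; else $\tau_0: A(x_1,\dots,x_{n-1},x_n-1,\ \tau_{n+1}: A(x_1,\dots,x_n,y-1))$. Here $\tau_0,\dots,\tau_{n+1}$ are the calls (occurrences of $A$ in the body), evaluated by leftmost reduction of term rewriting with $x-1$ truncated. State transition for a call $\tau$: $(A,\mathbf u)\xrightarrow{\tau}(A,\mathbf v)$ iff the body evaluated at $\mathbf u$ selects the branch containing $\tau$ and the argument terms of $\tau$ evaluated at $\mathbf u$ reduce to $\mathbf v$. A size-change graph $G:A\to A$ is a set of strict arcs $x\xrightarrow{\downarrow}x'$ and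 non-strict arcs $x\xrightarrow{\Downarrow}x'$ between parameters; $\mathbf u\xrightarrow{G}\mathbf v$ iff $u_x>v_{x'}$ for strict arcs and $u_x\ge v_{x'}$ for non-strict arcs. $G$ safely describes $\tau$ if $\xrightarrow{\tau}\subseteq\xrightarrow{G}$. Composition $G;H$: $x\xrightarrow{\downarrow}z$ iff there is $y$ with arcs $x\to y\in G$, $y\to z\in H$, at least one strict; $x\xrightarrow{\Downarrow}z$ iff there is such $y$ with both non-strict and $x\xrightarrow{\downarrow}z\notin G;H$. A description (a graph for each call) is ISCT if every graph $G$ in its closure under composition with $G;G=G$ contains a strict arc $x\xrightarrow{\downarrow}x$. $\mathcal A_n=\{A_1,\dots,A_{n+1}\}$ where, for $0<j\le n+1$, $A_j$ is the size-change graph with arcs $x_j\xrightarrow{\downarrow}x_j$ and $x_i\xrightarrow{\Downarrow}x_i$ for all $0<i<j$; $\mathcal A_n$ is regarded as the description assigning $A_i$ to $\tau_i$ ($0<i\le n+1$) and $A_n$ to $\tau_0$. -}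

module Defs where

open import Data.Nat using (ℕ; zero; suc; _∸_; _<_; _≤_; _≟_)
open import Data.Fin using (Fin; toℕ; inject₁; fromℕ)
open import Data.List using (foldr; map; allFin)
open import Data.Bool using (if_then_else_)
open import Data.Product using (Σ; _×_)
open import Relation.Nullary using (¬_)
open import Relation.Nullary.Decidable using (⌊_⌋)
open import Relation.Binary.PropositionalEquality using (_≡_)

-- The program A^n_f.
-- Parameters x_1,…,x_n,x_{n+1}=y are indexed by k : Fin (suc n);
-- index k stands for x_{toℕ k + 1}; y is index fromℕ n.

State : ℕ → Set
State n = Fin (suc n) → ℕ

yIx : (n : ℕ) → Fin (suc n)
yIx n = fromℕ n

data Call (n : ℕ) : Set where
  τ₀    : Call n
  τ     : Fin n → Call n      -- τ i  is the call τ_{toℕ i + 1}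
  τlast : Call n              -- τ_{n+1}

GBase : (n : ℕ) → State n → Set
GBase n u = ∀ (k : Fin (suc n)) → toℕ k < n → u k ≡ 0

GCall : (n : ℕ) → Fin n → State n → Set
GCall n i u =
  (0 < u (inject₁ i))
  × (∀ (k : Fin n) → toℕ i < toℕ k → u (inject₁ k) ≡ 0)
  × (suc (toℕ i) ≡ n → u (yIx n) ≡ 0)

SelBase : (n : ℕ) → State n → Set
SelBase n u = GBase n u

SelCall : (n : ℕ) → Fin n → State n → Set
SelCall n i u =
  GCall n i u × ¬ GBase n u × (∀ (j : Fin n) → toℕ j < toℕ i → ¬ GCall n j u)

SelElse : (n : ℕ) → State n → Set
SelElse n u = ¬ GBase n u × (∀ (j : Fin n) → ¬ GCall n j u)

-- Arguments of τ_{i+1}: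
--  if i+1 < n : A(x_1,…,x_{i+1}-1, y, x_{i+3},…,x_n, y)
--  if i+1 = n : A(x_1,…,x_n-1, 1)
argsCall : (n : ℕ) → Fin n → State n → State n
argsCall n i u k =
  if ⌊ toℕ k ≟ toℕ i ⌋ then u k ∸ 1
  else if ⌊ toℕ k ≟ suc (toℕ i) ⌋
       then (if ⌊ suc (toℕ i) ≟ n ⌋ then 1 else u (yIx n))
       else u k

argsInner : (n : ℕ) → State n → State n
argsInner n u k = if ⌊ toℕ k ≟ n ⌋ then u k ∸ 1 else u k

-- Arguments of τ₀, given the value w of the inner call τ_{n+1}:
-- A(x_1,…,x_{n-1}, x_n-1, w)
argsOuter : (n : ℕ) → State n → ℕ → State n
argsOuter n u w k =
  if ⌊ toℕ k ≟ n ⌋ then w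
  else if ⌊ suc (toℕ k) ≟ n ⌋ then u k ∸ 1
  else u k

-- Big-step evaluation (leftmost-innermost reduction) of A^n_f:
-- Eval n f u w  means  A(u) reduces to the value w.
data Eval (n : ℕ) (f : ℕ → ℕ) : State n → ℕ → Set where
  evBase : ∀ {u} → SelBase n u → Eval n f u (f (u (yIx n)))
  evCall : ∀ {u w} (i : Fin n) → SelCall n i u →
           Eval n f (argsCall n i u) w → Eval n f u w
  evElse : ∀ {u w' w} → SelElse n u →
           Eval n f (argsInner n u) w' →
           Eval n f (argsOuter n u w') w → Eval n f u w

Trans : (n : ℕ) → (ℕ → ℕ) → Call n → State n → State n → Set
Trans n f τ₀ u v =
  SelElse n u × Σ ℕ (λ w → Eval n f (argsInner n u) w
                           × (∀ k → v k ≡ argsOuter n u w k))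
Trans n f (τ i) u v = SelCall n i u × (∀ k → v k ≡ argsCall n i u k)
Trans n f τlast u v = SelElse n u × (∀ k → v k ≡ argsInner n u k)

-- Size-change graphs A → A (at most one arc per pair of parameters).

data Arc : Set where
  none nonstrict strict : Arc

Graph : ℕ → Set
Graph n = Fin (suc n) → Fin (suc n) → Arc

_⊢_⟶_ : ∀ {n} → Graph n → State n → State n → Set
G ⊢ u ⟶ v = ∀ x x' → (G x x' ≡ strict → v x' < u x)
                    × (G x x' ≡ nonstrict → v x' ≤ u x)

SafelyDescribes : (n : ℕ) → (ℕ → ℕ) → Graph n → Call n → Set
SafelyDescribes n f G c = ∀ u v → Trans n f c u v → G ⊢ u ⟶ v

seqArc : Arc → Arc → Arc
seqArc none _ = none
seqArc _ none = none
seqArc strict _ = strict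
seqArc nonstrict b = b

_⊔ₐ_ : Arc → Arc → Arc
none ⊔ₐ b = b
strict ⊔ₐ _ = strict
nonstrict ⊔ₐ none = nonstrict
nonstrict ⊔ₐ nonstrict = nonstrict
nonstrict ⊔ₐ strict = strict

-- G ; H : strict arc x→z iff some y with arcs x→y, y→z, one strict;
-- non-strict arc iff some y with both non-strict and no strict arc.
_⨾_ : ∀ {n} → Graph n → Graph n → Graph n
_⨾_ {n} G H x z = foldr _⊔ₐ_ none (map (λ y → seqArc (G x y) (H y z)) (allFin (suc n)))

_≈G_ : ∀ {n} → Graph n → Graph n → Set
G ≈G H = ∀ x y → G x y ≡ H x y

Description : ℕ → Set
Description n = Call n → Graph n

data Closure {n : ℕ} (D : Description n) : Graph n → Set where
  gen  : (c : Call n) → Closure D (D c)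
  comp : ∀ {G H} → Closure D G → Closure D H → Closure D (G ⨾ H)

ISCT : (n : ℕ) → Description n → Set
ISCT n D = ∀ G → Closure D G → (G ⨾ G) ≈G G → Σ (Fin (suc n)) (λ x → G x x ≡ strict)

SafeDescription : (n : ℕ) → (ℕ → ℕ) → Description n → Set
SafeDescription n f D = ∀ (c : Call n) → SafelyDescribes n f (D c) c

-- The graphs A_j (j ≥ 1): x_j ↓ x_j and x_i ⇓ x_i for 0 < i < j.

AGraph : (n : ℕ) → ℕ → Graph n
AGraph n j x x' =
  if ⌊ toℕ x ≟ toℕ x' ⌋
  then (if ⌊ suc (toℕ x) ≟ j ⌋ then strict
        else if ⌊ suc (suc (toℕ x)) Data.Nat.≤? j ⌋ then nonstrict
        else none)
  else none

𝒜 : (n : ℕ) → Description n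
𝒜 n τ₀ = AGraph n n
𝒜 n (τ i) = AGraph n (suc (toℕ i))
𝒜 n τlast = AGraph n (suc n)

module Submission where

-- Every graph of 𝒜ₙ lies on the diagonal: the arc of A_j from
-- x_i to x_i is strict for i = j, non-strict for i < j, and absent otherwise,
-- and there are no arcs between distinct parameters.
--
-- A_j describes a transition u → v as soon as x_j strictly decreases
-- and x_1,…,x_{j-1} do not increase (A-sound).  For τ_i (i ≤ n) the guard
-- gives x_i > 0, and the call decrements x_i leaving x_1,…,x_{i-1} unchanged.
-- For τ_{n+1} and τ₀ we need that in the final else-branch both y > 0 and
-- x_n > 0: otherwise a downward induction over the parameters shows that
-- either some guard of τ_1,…,τ_n holds or x_1 = … = x_n = 0 (allZero), which
-- contradicts the selection of that branch.
--
-- Diagonal arcs compose pointwise, giving A_a ; A_b = A_{min a b}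
-- (A-⨾).  Hence every graph in the closure of 𝒜ₙ is (extensionally) some A_j
-- with 1 ≤ j ≤ n+1, and every such A_j has the strict loop x_j ↓ x_j.

open import Defs
open import Data.Nat using (ℕ; zero; suc; _<_; _≤_; _∸_; _+_; _⊓_; z≤n; s≤s; z<s)
open import Data.Nat.Properties
  using (_≟_; _≤?_; <⇒≢; m<n⇒m<1+n; m≤n⇒m<n∨m≡n; n≢0⇒n>0; ∸-monoʳ-<;
         <-irrefl; ≤-refl; ≤-trans; n≤1+n; ≤-<-trans; m⊓n≤m; +-suc; +-identityʳ; suc-injective; n<1+n)
open import Data.Fin using (Fin; toℕ; inject₁; fromℕ<) renaming (zero to fzero; suc to fsuc)
import Data.Fin.Properties as Fin
open import Data.List using (foldr; map; allFin; tabulate)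
open import Data.List.Properties using (map-cong; map-tabulate)
open import Data.Product using (Σ; _×_; _,_; proj₁)
open import Data.Sum using (inj₁; inj₂)
open import Data.Bool using (if_then_else_)
open import Data.Empty using (⊥-elim)
open import Relation.Nullary using (Dec; does; ¬_; yes; no)
open import Relation.Nullary.Decidable using (⌊_⌋; isYes≗does; dec-true; dec-false)
open import Relation.Binary.PropositionalEquality
  using (_≡_; _≢_; refl; sym; trans; cong; cong₂; subst)

private
  variable
    n : ℕ

if-yes : ∀ {p a} {P : Set p} {A : Set a} (P? : Dec P) {x y : A} →
         P → (if ⌊ P? ⌋ then x else y) ≡ x
if-yes P? p rewrite isYes≗does P? | dec-true P? p = refl

if-no : ∀ {p a} {P : Set p} {A : Set a} (P? : Dec P) {x y : A} →
        ¬ P → (if ⌊ P? ⌋ then x else y) ≡ y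
if-no P? ¬p rewrite isYes≗does P? | dec-false P? ¬p = refl

pred< : ∀ {m} → 0 < m → m ∸ 1 < m
pred< = ∸-monoʳ-< z<s

inject₁-fromℕ< : (k : Fin (suc n)) (k<n : toℕ k < n) → inject₁ (fromℕ< k<n) ≡ k
inject₁-fromℕ< k k<n = Fin.toℕ-injective (trans (Fin.toℕ-inject₁ _) (Fin.toℕ-fromℕ< k<n))

-- diagArc j t : the arc of A_j from x_{t+1} to itself.
diagArc : ℕ → ℕ → Arc
diagArc zero          t       = none
diagArc (suc j)       (suc t) = diagArc j t
diagArc (suc zero)    zero    = strict
diagArc (suc (suc j)) zero    = nonstrict

AGraph-diag : ∀ n j (x : Fin (suc n)) → AGraph n j x x ≡ diagArc j (toℕ x)
AGraph-diag n j x = trans (if-yes (toℕ x ≟ toℕ x) refl) (byDoes j (toℕ x))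
  where
  byDoes : ∀ j t → (if ⌊ suc t ≟ j ⌋ then strict
                    else if ⌊ suc (suc t) ≤? j ⌋ then nonstrict else none) ≡ diagArc j t
  byDoes j t rewrite isYes≗does (suc t ≟ j) | isYes≗does (suc (suc t) ≤? j) = go j t
    where
    -- on the Boolean parts both decisions compute by recursion on the numbers
    go : ∀ j t → (if does (suc t ≟ j) then strict
                  else if does (suc (suc t) ≤? j) then nonstrict else none) ≡ diagArc j t
    go zero          t       = refl
    go (suc j)       (suc t) = go j t
    go (suc zero)    zero    = refl
    go (suc (suc j)) zero    = refl

AGraph-off : ∀ n j (x x' : Fin (suc n)) → x ≢ x' → AGraph n j x x' ≡ none
AGraph-off n j x x' x≢x' = if-no (toℕ x ≟ toℕ x') (λ e → x≢x' (Fin.toℕ-injective e))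

diagArc-strict : ∀ j t → diagArc j t ≡ strict → suc t ≡ j
diagArc-strict (suc j)    (suc t) e    = cong suc (diagArc-strict j t e)
diagArc-strict (suc zero) zero    refl = refl

diagArc-nonstrict : ∀ j t → diagArc j t ≡ nonstrict → suc (suc t) ≤ j
diagArc-nonstrict (suc j)       (suc t) e    = s≤s (diagArc-nonstrict j t e)
diagArc-nonstrict (suc (suc j)) zero    refl = s≤s (s≤s z≤n)

diagArc-loop : ∀ j → diagArc (suc j) j ≡ strict
diagArc-loop zero    = refl
diagArc-loop (suc j) = diagArc-loop j

⊢-resp : ∀ {G : Graph n} {u v w : State n} → (∀ k → v k ≡ w k) → G ⊢ u ⟶ w → G ⊢ u ⟶ v
⊢-resp {u = u} v≗w G⊢ x x' with G⊢ x x'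
... | strictOk , nonstrictOk =
  (λ e → subst (_< u x) (sym (v≗w x')) (strictOk e)) ,
  (λ e → subst (_≤ u x) (sym (v≗w x')) (nonstrictOk e))

A-sound : ∀ {j} {u v : State n} →
          (∀ x → suc (toℕ x) ≡ j → v x < u x) →
          (∀ x → suc (suc (toℕ x)) ≤ j → v x ≤ u x) →
          AGraph n j ⊢ u ⟶ v
A-sound {n} {j} decreases nonIncreasing x x' with x Fin.≟ x'
... | yes refl rewrite AGraph-diag n j x =
  (λ e → decreases x (diagArc-strict j (toℕ x) e)) ,
  (λ e → nonIncreasing x (diagArc-nonstrict j (toℕ x) e))
... | no x≢x' rewrite AGraph-off n j x x' x≢x' = (λ ()) , (λ ())

argsCall-self : ∀ n i u (x : Fin (suc n)) → toℕ x ≡ toℕ i → argsCall n i u x ≡ u x ∸ 1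
argsCall-self n i u x e = if-yes (toℕ x ≟ toℕ i) e

argsCall-below : ∀ n i u (x : Fin (suc n)) → toℕ x < toℕ i → argsCall n i u x ≡ u x
argsCall-below n i u x x<i =
  trans (if-no (toℕ x ≟ toℕ i) (<⇒≢ x<i)) (if-no (toℕ x ≟ suc (toℕ i)) (<⇒≢ (m<n⇒m<1+n x<i)))

argsInner-y : ∀ n u (x : Fin (suc n)) → toℕ x ≡ n → argsInner n u x ≡ u x ∸ 1
argsInner-y n u x e = if-yes (toℕ x ≟ n) e

argsInner-below : ∀ n u (x : Fin (suc n)) → toℕ x < n → argsInner n u x ≡ u x
argsInner-below n u x x<n = if-no (toℕ x ≟ n) (<⇒≢ x<n)

argsOuter-last : ∀ n u w (x : Fin (suc n)) → suc (toℕ x) ≡ n → argsOuter n u w x ≡ u x ∸ 1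
argsOuter-last n u w x e =
  trans (if-no (toℕ x ≟ n) (λ x≡n → <-irrefl (trans x≡n (sym e)) (n<1+n _)))
        (if-yes (suc (toℕ x) ≟ n) e)

argsOuter-below : ∀ n u w (x : Fin (suc n)) → suc (suc (toℕ x)) ≤ n → argsOuter n u w x ≡ u x
argsOuter-below n u w x x+1<n =
  trans (if-no (toℕ x ≟ n) (<⇒≢ (≤-trans (n≤1+n _) x+1<n)))
        (if-no (suc (toℕ x) ≟ n) (<⇒≢ x+1<n))

module AllZero (n : ℕ) (u : State n)
               (noCall : ∀ (j : Fin n) → ¬ GCall n j u)
               (lastGuard : ∀ (x : Fin (suc n)) → suc (toℕ x) ≡ n → 0 < u x → u (yIx n) ≡ 0)
               where

  ZeroFrom : ℕ → Set
  ZeroFrom m = ∀ (k : Fin n) → m ≤ toℕ k → u (inject₁ k) ≡ 0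

  -- if x_{m+1} were positive, the guard of τ_{m+1} would hold
  step : ∀ {m} → ZeroFrom (suc m) → ZeroFrom m
  step above k m≤k with m≤n⇒m<n∨m≡n m≤k
  ... | inj₁ m<k = above k m<k
  ... | inj₂ refl with u (inject₁ k) ≟ 0
  ...   | yes xₖ≡0 = xₖ≡0
  ...   | no xₖ≢0 = ⊥-elim (noCall k (positive , above , yZero))
    where
    positive : 0 < u (inject₁ k)
    positive = n≢0⇒n>0 xₖ≢0
    yZero : suc (toℕ k) ≡ n → u (yIx n) ≡ 0
    yZero last = lastGuard (inject₁ k) (trans (cong suc (Fin.toℕ-inject₁ k)) last) positive

  zeroFrom : ∀ d m → d + m ≡ n → ZeroFrom m
  zeroFrom zero    m refl k m≤k = ⊥-elim (<-irrefl refl (≤-<-trans m≤k (Fin.toℕ<n k)))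
  zeroFrom (suc d) m e          = step (zeroFrom d (suc m) (trans (+-suc d m) e))

  allZero : GBase n u
  allZero k k<n = subst (λ z → u z ≡ 0) (inject₁-fromℕ< k k<n)
                    (zeroFrom n 0 (+-identityʳ n) (fromℕ< k<n) z≤n)

else-y>0 : ∀ n u → SelElse n u → 0 < u (yIx n)
else-y>0 n u (¬base , noCall) = n≢0⇒n>0 λ y≡0 → ¬base (AllZero.allZero n u noCall (λ _ _ _ → y≡0))

else-xₙ>0 : ∀ n u → SelElse n u → ∀ x → suc (toℕ x) ≡ n → 0 < u x
else-xₙ>0 n u (¬base , noCall) x x=n =
  n≢0⇒n>0 λ xₙ≡0 → ¬base (AllZero.allZero n u noCall (vacuous xₙ≡0))
  where
  -- with x_n = 0 the premise x_n > 0 of the last guard is never met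
  vacuous : u x ≡ 0 → ∀ x' → suc (toℕ x') ≡ n → 0 < u x' → u (yIx n) ≡ 0
  vacuous xₙ≡0 x' x'=n x'>0 with Fin.toℕ-injective (suc-injective (trans x'=n (sym x=n)))
  ... | refl = ⊥-elim (<-irrefl (sym xₙ≡0) x'>0)

safe : ∀ n f → SafeDescription n f (𝒜 n)
safe n f (τ i) u v (sel , v≗args) = ⊢-resp v≗args (A-sound decreases nonIncreasing)
  where
  decreases : ∀ x → suc (toℕ x) ≡ suc (toℕ i) → argsCall n i u x < u x
  decreases x e rewrite argsCall-self n i u x (suc-injective e) = pred< xᵢ>0
    where
    xᵢ>0 : 0 < u x
    xᵢ>0 = subst (λ z → 0 < u z)
             (Fin.toℕ-injective (trans (Fin.toℕ-inject₁ i) (sym (suc-injective e))))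
             (proj₁ (proj₁ sel))
  nonIncreasing : ∀ x → suc (suc (toℕ x)) ≤ suc (toℕ i) → argsCall n i u x ≤ u x
  nonIncreasing x (s≤s x<i) rewrite argsCall-below n i u x x<i = ≤-refl
safe n f τlast u v (sel , v≗args) = ⊢-resp v≗args (A-sound decreases nonIncreasing)
  where
  decreases : ∀ x → suc (toℕ x) ≡ suc n → argsInner n u x < u x
  decreases x e rewrite argsInner-y n u x (suc-injective e) = pred< y>0
    where
    y>0 : 0 < u x
    y>0 = subst (λ z → 0 < u z)
            (Fin.toℕ-injective (trans (Fin.toℕ-fromℕ n) (sym (suc-injective e))))
            (else-y>0 n u sel)
  nonIncreasing : ∀ x → suc (suc (toℕ x)) ≤ suc n → argsInner n u x ≤ u x
  nonIncreasing x (s≤s x<n) rewrite argsInner-below n u x x<n = ≤-refl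
safe n f τ₀ u v (sel , w , _ , v≗args) = ⊢-resp v≗args (A-sound decreases nonIncreasing)
  where
  decreases : ∀ x → suc (toℕ x) ≡ n → argsOuter n u w x < u x
  decreases x e rewrite argsOuter-last n u w x e = pred< (else-xₙ>0 n u sel x e)
  nonIncreasing : ∀ x → suc (suc (toℕ x)) ≤ n → argsOuter n u w x ≤ u x
  nonIncreasing x x+1<n rewrite argsOuter-below n u w x x+1<n = ≤-refl

seqArc-none : ∀ a → seqArc a none ≡ none
seqArc-none none      = refl
seqArc-none nonstrict = refl
seqArc-none strict    = refl

diagArc-⨾ : ∀ a b t → seqArc (diagArc a t) (diagArc b t) ≡ diagArc (a ⊓ b) t
diagArc-⨾ zero          b             t       = refl
diagArc-⨾ (suc a)       zero          t       = seqArc-none (diagArc (suc a) t)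
diagArc-⨾ (suc a)       (suc b)       (suc t) = diagArc-⨾ a b t
diagArc-⨾ (suc zero)    (suc zero)    zero    = refl
diagArc-⨾ (suc zero)    (suc (suc b)) zero    = refl
diagArc-⨾ (suc (suc a)) (suc zero)    zero    = refl
diagArc-⨾ (suc (suc a)) (suc (suc b)) zero    = refl

⊔ₐ-none : ∀ a → (a ⊔ₐ none) ≡ a
⊔ₐ-none none      = refl
⊔ₐ-none nonstrict = refl
⊔ₐ-none strict    = refl

join-single : ∀ m (h : Fin m → Arc) (y₀ : Fin m) → (∀ y → y ≢ y₀ → h y ≡ none) →
              foldr _⊔ₐ_ none (map h (allFin m)) ≡ h y₀
join-single m h y₀ others = trans (cong (foldr _⊔ₐ_ none) (map-tabulate (λ y → y) h)) (go m h y₀ others)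
  where
  absent : ∀ m (h : Fin m → Arc) → (∀ y → h y ≡ none) → foldr _⊔ₐ_ none (tabulate h) ≡ none
  absent zero    h _   = refl
  absent (suc m) h all rewrite all fzero = absent m (λ y → h (fsuc y)) (λ y → all (fsuc y))
  go : ∀ m (h : Fin m → Arc) (y₀ : Fin m) → (∀ y → y ≢ y₀ → h y ≡ none) →
       foldr _⊔ₐ_ none (tabulate h) ≡ h y₀
  go (suc m) h fzero others
    rewrite absent m (λ y → h (fsuc y)) (λ y → others (fsuc y) (λ ())) = ⊔ₐ-none (h fzero)
  go (suc m) h (fsuc y₀) others rewrite others fzero (λ ()) =
    go m (λ y → h (fsuc y)) y₀ (λ y y≢y₀ → others (fsuc y) (λ e → y≢y₀ (Fin.suc-injective e)))

-- A_a ; A_b = A_{min a b}: only the path through the middle parameter x = source contributes.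
A-⨾ : ∀ n a b → (AGraph n a ⨾ AGraph n b) ≈G AGraph n (a ⊓ b)
A-⨾ n a b x z =
  trans (join-single (suc n) (λ y → seqArc (AGraph n a x y) (AGraph n b y z)) x
          (λ y y≢x → cong (λ arc → seqArc arc (AGraph n b y z)) (AGraph-off n a x y (λ e → y≢x (sym e)))))
        (lastStep z)
  where
  lastStep : ∀ z → seqArc (AGraph n a x x) (AGraph n b x z) ≡ AGraph n (a ⊓ b) x z
  lastStep z with x Fin.≟ z
  ... | yes refl rewrite AGraph-diag n a x | AGraph-diag n b x | AGraph-diag n (a ⊓ b) x =
    diagArc-⨾ a b (toℕ x)
  ... | no x≢z rewrite AGraph-off n b x z x≢z | AGraph-off n (a ⊓ b) x z x≢z =
    seqArc-none (AGraph n a x x)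

⨾-cong : ∀ {G G' H H' : Graph n} → G ≈G G' → H ≈G H' → (G ⨾ H) ≈G (G' ⨾ H')
⨾-cong {n} G≈G' H≈H' x z =
  cong (foldr _⊔ₐ_ none) (map-cong (λ y → cong₂ seqArc (G≈G' x y) (H≈H' y z)) (allFin (suc n)))

IsA : (n : ℕ) → Graph n → Set
IsA n G = Σ ℕ λ j → j < suc n × G ≈G AGraph n (suc j)

-- The closure of 𝒜ₙ stays among A_1,…,A_{n+1}, since A_a ; A_b = A_{min a b}.
closure-IsA : ∀ n → 0 < n → ∀ G → Closure (𝒜 n) G → IsA n G
closure-IsA (suc m) _ _ (gen τ₀)    = m , m<n⇒m<1+n (n<1+n m) , λ _ _ → refl
closure-IsA n       _ _ (gen (τ i)) = toℕ i , m<n⇒m<1+n (Fin.toℕ<n i) , λ _ _ → refl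
closure-IsA n       _ _ (gen τlast) = n , n<1+n n , λ _ _ → refl
closure-IsA n n>0 _ (comp cG cH) with closure-IsA n n>0 _ cG | closure-IsA n n>0 _ cH
... | a , a≤n , G≈Aa | b , _ , H≈Ab =
  a ⊓ b , ≤-<-trans (m⊓n≤m a b) a≤n , λ x z → trans (⨾-cong G≈Aa H≈Ab x z) (A-⨾ n (suc a) (suc b) x z)

-- A_{j+1} has the strict loop at x_{j+1}, which is a parameter because j ≤ n.
IsA-loop : ∀ n G → IsA n G → Σ (Fin (suc n)) λ x → G x x ≡ strict
IsA-loop n G (j , j≤n , G≈Aj) = x , trans (G≈Aj x x) (trans (AGraph-diag n (suc j) x) loop)
  where
  x : Fin (suc n)
  x = fromℕ< j≤n
  loop : diagArc (suc j) (toℕ x) ≡ strict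
  loop rewrite Fin.toℕ-fromℕ< j≤n = diagArc-loop j

isct : ∀ n → 0 < n → ISCT n (𝒜 n)
isct n n>0 G cG _ = IsA-loop n G (closure-IsA n n>0 G cG)

proposition4p12 : (n : ℕ) → 0 < n → (f : ℕ → ℕ) →
    SafeDescription n f (𝒜 n) × ISCT n (𝒜 n)
proposition4p12 n n>0 f = safe n f , isct n n>0
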